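{- Let $O$ be an occurrence p-net with its initial state, let $\sigma=t_1;\cdots;t_n$ ($n\ge0$) be a (possibly empty) non-stuttering firing sequence of $O$ from its initial state, and let $t$ be a transition of $O$ not occurring in $\sigma$. The following are equivalent: (i) $t$ is enabled after $\sigma$; (ii) some collection of causes of $t$ is contained in $\{t_1,\dots,t_n\}$; (iii) the propositional formula $\bigwedge_{i=1}^n t_i$ implies $\Phi(t)$.
   Context: A p-net is $(P\uplus\mathbf{P},T,F)$ with regular places $P$, persistent places $\mathbf{P}$, transitions $T$, flow $F\subseteq((P\cup\mathbf{P})\times T)\cup(T\times(P\cup\mathbf{P}))$; ${}^\bullet x=\{y\mid(y,x)\in F\}$, $x^\bullet=\{z\mid(x,z)\in F\}$; transitions have nonempty presets. States are bags $b:P\cup\mathbf{P}\to\mathbb{N}\cup\{\infty\}$ with $b(p)\in\mathbb{N}$ on regular and $b(\mathbf{p})\in\{0,\infty\}$ on persistent places. $t$ is enabled at $b$ iff $b(s)\ge1$ for all $s\in{}^\bullet t$; firing yields $b'$ with $b'(s)=b(s)-[s\in{}^\bullet t]+[s\in t^\bullet]$ on regular places and $b'(\mathbf{p})=\infty$ if $\mathbf{p}\in t^\bullet$ or $b(\mathbf{p})=\infty$, else $0$, on persistent places. A firing sequence is non-stuttering if no transition occurs more than once. An occurrence p-net is an acyclic p-net with $|{}^\bullet p|\le1$ and $|p^\bullet|\le1$ for every regular place $p$ (persistent places may have several input and output transitions). Its initial state marks each regular place with empty preset with $1$ token and each persistent place with empty preset with $\infty$, and all other places with $0$. Causes: treat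 transitions as propositional variables and define by well-founded recursion $\Phi(x)=\mathit{true}$ for a place $x$ with ${}^\bullet x=\emptyset$; $\Phi(x)=\bigvee_{u\in{}^\bullet x}(u\wedge\Phi(u))$ for a place with nonempty preset; $\Phi(x)=\bigwedge_{s\in{}^\bullet x}\Phi(s)$ for a transition $x$. $\Phi(x)$ is a monotone (negation-free) formula; its unique disjunctive normal form consisting of its prime implicants is a set of sets of transitions, called the collections of causes of $x$ (the empty collection corresponding to $\mathit{true}$). -}

module Defs where

open import Data.Nat using (ℕ; zero; suc; _+_; _∸_; _≤_)
open import Data.Bool using (Bool; true; false; _∨_; if_then_else_)
open import Data.Fin using (Fin)
open import Data.Fin.Subset as S using (Subset)
open import Data.Sum using (_⊎_; inj₁; inj₂)
open import Data.Product using (Σ; ∃; _×_; _,_)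
open import Data.List using (List; []; _∷_; allFin)
open import Data.Bool.ListAction using (any)
open import Data.Empty using (⊥)
open import Data.List.Relation.Unary.Unique.Propositional using (Unique)
import Data.List.Membership.Propositional as LM
open import Relation.Binary.PropositionalEquality using (_≡_)
open import Relation.Binary.Construct.Closure.Transitive using (TransClosure)
open import Relation.Nullary using (¬_)

-- Places are  Fin np ⊎ Fin nq  (inj₁ = regular, inj₂ = persistent).
-- The flow relation F is given by two Boolean matrices:
--   inF s t  ⇔ (s , t) ∈ F     (place → transition)
--   outF t s ⇔ (t , s) ∈ F     (transition → place)
record PNet : Set where
  field
    np nq nt : ℕ
    inF  : Fin np ⊎ Fin nq → Fin nt → Bool
    outF : Fin nt → Fin np ⊎ Fin nq → Bool
    preNonempty : (t : Fin nt) → ∃ λ s → inF s t ≡ true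

  Place : Set
  Place = Fin np ⊎ Fin nq

  Trans : Set
  Trans = Fin nt

  Node : Set
  Node = Place ⊎ Trans

  Flow : Node → Node → Set
  Flow (inj₁ s) (inj₂ t) = inF s t ≡ true
  Flow (inj₂ t) (inj₁ s) = outF t s ≡ true
  Flow _ _ = ⊥

  -- States: bags; regular places carry a natural number, persistent
  -- places carry 0 or ∞, encoded as false / true.
  record State : Set where
    constructor ⟨_,_⟩
    field
      reg  : Fin np → ℕ
      pers : Fin nq → Bool
  open State public

  Marked : State → Place → Set
  Marked b (inj₁ p) = 1 ≤ reg b p
  Marked b (inj₂ q) = pers b q ≡ true

  Enabled : State → Trans → Set
  Enabled b t = (s : Place) → inF s t ≡ true → Marked b s

  ind : Bool → ℕ
  ind true  = 1
  ind false = 0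

  fire : State → Trans → State
  fire b t = ⟨ (λ p → (reg b p ∸ ind (inF (inj₁ p) t)) + ind (outF t (inj₁ p)))
             , (λ q → pers b q ∨ outF t (inj₂ q)) ⟩

  data FiringSeq : State → List Trans → State → Set where
    []  : ∀ {b} → FiringSeq b [] b
    _∷_ : ∀ {b t σ b'} → Enabled b t → FiringSeq (fire b t) σ b' →
          FiringSeq b (t ∷ σ) b'

  NonStuttering : List Trans → Set
  NonStuttering σ = Unique σ

  hasPreset : Place → Bool
  hasPreset s = any (λ u → outF u s) (allFin nt)

  initial : State
  initial = ⟨ (λ p → if hasPreset (inj₁ p) then 0 else 1)
            , (λ q → if hasPreset (inj₂ q) then false else true) ⟩

  record IsOccurrence : Set where
    field
      acyclic : (x : Node) → ¬ TransClosure Flow x x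
      regPre  : (p : Fin np) (u u' : Trans) →
                outF u (inj₁ p) ≡ true → outF u' (inj₁ p) ≡ true → u ≡ u'
      regPost : (p : Fin np) (u u' : Trans) →
                inF (inj₁ p) u ≡ true → inF (inj₁ p) u' ≡ true → u ≡ u'

  Valuation : Set
  Valuation = Trans → Bool

  -- Semantics of the cause formulas Φ: v ⊨ Φ(x).  This is the inductive
  -- reading of the recursive clauses
  --   Φ(p) = true                         if •p = ∅
  --   Φ(p) = ⋁_{u ∈ •p} (u ∧ Φ(u))        otherwise
  --   Φ(t) = ⋀_{s ∈ •t} Φ(s)
  -- which for an acyclic (occurrence) net coincides with the
  -- well-founded recursive definition.
  data SatP (v : Valuation) : Place → Set
  SatT : Valuation → Trans → Set

  data SatP v where
    noPre : ∀ {s} → ((u : Trans) → outF u s ≡ false) → SatP v s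
    viaPre : ∀ {s} (u : Trans) → outF u s ≡ true → v u ≡ true →
             SatT v u → SatP v s

  SatT v t = (s : Place) → inF s t ≡ true → SatP v s

  Implicant : Subset nt → Trans → Set
  Implicant C t = (v : Valuation) → ((u : Trans) → u S.∈ C → v u ≡ true) → SatT v t

  -- collections of causes of t = prime implicants of Φ(t)
  CollectionOfCauses : Subset nt → Trans → Set
  CollectionOfCauses C t = Implicant C t × ((D : Subset nt) → D S.⊂ C → ¬ Implicant D t)

  ConjImplies : List Trans → Trans → Set
  ConjImplies σ t = (v : Valuation) → ((u : Trans) → u LM.∈ σ → v u ≡ true) → SatT v t

module Submission where

-- (i) ⇒ (iii): under any valuation making σ true, every place marked
--   along the run satisfies its cause formula (an invariant of firing).
-- (iii) ⇒ (i): evaluate Φ(t) at the valuation "u is true iff u ∈ σ".  Each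
--   input place s of t is then initially marked or produced by some u ∈ σ;
--   since t is the only consumer of a regular input place of t and t ∉ σ,
--   s is still marked after σ.
-- (iii) ⇒ (ii): Φ(t) is decidable at every valuation (the satisfied
--   transitions form the least fixpoint of a monotone operator on finite
--   subsets, reached by Kleene iteration), so implicants of Φ(t) are a
--   decidable, upward-closed family of subsets; the implicant σ therefore
--   contains a ⊂-minimal one, i.e. a collection of causes.
-- (ii) ⇒ (iii) is immediate since implicants are upward closed.

open import Defs
open import Level using (Level)
open import Data.Nat using (ℕ; zero; suc; _≤_; _<_; z≤n; s≤s)
open import Data.Nat.Properties using (≤-trans; ≤-<-trans; m≤m+n; m≤n+m; m∸n≤m; +-identityʳ; 1+n≰n)
open import Data.Nat.Induction using (<-wellFounded)
open import Induction.WellFounded using (Acc; acc)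
open import Data.Bool using (true; false; T)
open import Data.Bool.Properties using (∨-zeroʳ; T-≡) renaming (_≟_ to _≟ᵇ_)
open import Data.Sum using (_⊎_; inj₁; inj₂)
open import Data.Product using (∃; _×_; _,_)
open import Data.Fin using (Fin)
open import Data.Fin.Properties using (any?; all?) renaming (_≟_ to _≟ᶠ_)
open import Data.Fin.Subset using (Subset; ⊥; _∈_; _⊆_; _⊂_; _-_; ∣_∣)
open import Data.Fin.Subset.Properties
  using (_∈?_; _⊆?_; ⊥⊆; ∉⊥; p─q⊆p; p⊂q⇒∣p∣<∣q∣; ∣p∣≤n; x∈p∧x≢y⇒x∈p-y; x∈p⇒∣p-x∣<∣p∣)
open import Data.List using (List; allFin)
open import Data.List.Relation.Unary.Any using (here; there; satisfied)
open import Data.List.Relation.Unary.Any.Properties using (any⁺; any⁻)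
open import Data.List.Membership.Propositional.Properties using (∈-allFin)
import Data.List.Membership.Propositional as LM
import Data.List.Membership.DecPropositional as DecLM
open import Data.Vec using (lookup; tabulate)
open import Data.Vec.Properties using ([]=⇒lookup; lookup⇒[]=; lookup∘tabulate)
open import Data.Empty using (⊥-elim)
open import Function using (_∘_; id)
open import Function.Bundles using (_⇔_; mk⇔; Equivalence)
open import Relation.Nullary using (¬_; Dec; yes; no; does)
open import Relation.Nullary.Decidable using (_⊎-dec_; _×-dec_; _→-dec_; ¬?; map′; decidable-stable; dec-true)
open import Relation.Unary using (Pred; Decidable)
open import Relation.Binary.PropositionalEquality using (_≡_; refl; sym; trans; subst)

private
  variable
    ℓ : Level
    n : ℕ

does⇒ : ∀ {A : Set ℓ} (a? : Dec A) → does a? ≡ true → A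
does⇒ (yes a) _ = a

lookup⇔∈ : ∀ (C : Subset n) {x} → lookup C x ≡ true ⇔ x ∈ C
lookup⇔∈ C {x} = mk⇔ (lookup⇒[]= x C) []=⇒lookup

⟦_⟧ : {P : Pred (Fin n) ℓ} → Decidable P → Subset n
⟦ P? ⟧ = tabulate (does ∘ P?)

∈⟦⟧⇔ : {P : Pred (Fin n) ℓ} (P? : Decidable P) {x : Fin n} → x ∈ ⟦ P? ⟧ ⇔ P x
∈⟦⟧⇔ P? {x} = mk⇔
  (λ x∈ → does⇒ (P? x) (trans (sym (lookup∘tabulate _ x)) (Equivalence.from (lookup⇔∈ ⟦ P? ⟧) x∈)))
  (λ Px → Equivalence.to (lookup⇔∈ ⟦ P? ⟧) (trans (lookup∘tabulate _ x) (dec-true (P? x) Px)))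

all⊎? : ∀ {m k} {P : Pred (Fin m ⊎ Fin k) ℓ} → Decidable P → Dec (∀ x → P x)
all⊎? P? = map′ (λ { (onLeft , onRight) → λ { (inj₁ x) → onLeft x ; (inj₂ y) → onRight y } })
                (λ all → all ∘ inj₁ , all ∘ inj₂)
                (all? (P? ∘ inj₁) ×-dec all? (P? ∘ inj₂))

⊆∧⊉⇒⊂ : {p q : Subset n} → p ⊆ q → ¬ q ⊆ p → p ⊂ q
⊆∧⊉⇒⊂ {p = p} {q} p⊆q q⊈p with any? (λ x → x ∈? q ×-dec ¬? (x ∈? p))
... | yes (x , x∈q , x∉p) = p⊆q , x , x∈q , x∉p
... | no none = ⊥-elim (q⊈p λ {x} x∈q →
                  decidable-stable (x ∈? p) (λ x∉p → none (x , x∈q , x∉p)))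

-- Kleene iteration of a monotone operator F on Subset n from the empty set.
-- After n + 1 steps it has reached an F-closed set, and every stage lies
-- inside any property that F propagates.
module Kleene (F : Subset n → Subset n) (F-mono : ∀ {p q} → p ⊆ q → F p ⊆ F q) where

  stage : ℕ → Subset n
  stage zero    = ⊥
  stage (suc k) = F (stage k)

  stage-increasing : ∀ k → stage k ⊆ stage (suc k)
  stage-increasing zero    = ⊥⊆
  stage-increasing (suc k) = F-mono (stage-increasing k)

  closed-or-large : ∀ k → F (stage k) ⊆ stage k ⊎ k ≤ ∣ stage k ∣
  closed-or-large zero = inj₂ z≤n
  closed-or-large (suc k) with F (stage k) ⊆? stage k | closed-or-large k
  ... | yes closed | _          = inj₁ (F-mono closed)
  ... | no grows   | inj₁ closed = ⊥-elim (grows closed)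
  ... | no grows   | inj₂ large  =
    inj₂ (≤-<-trans large (p⊂q⇒∣p∣<∣q∣ (⊆∧⊉⇒⊂ (stage-increasing k) grows)))

  fixpoint : Subset n
  fixpoint = stage (suc n)

  fixpoint-closed : F fixpoint ⊆ fixpoint
  fixpoint-closed with closed-or-large (suc n)
  ... | inj₁ closed = closed
  ... | inj₂ large  = ⊥-elim (1+n≰n (≤-trans large (∣p∣≤n fixpoint)))

  stage-within : {Q : Pred (Fin n) ℓ} →
    (∀ p → (∀ {x} → x ∈ p → Q x) → ∀ {x} → x ∈ F p → Q x) →
    ∀ k {x} → x ∈ stage k → Q x
  stage-within step zero    x∈⊥ = ⊥-elim (∉⊥ x∈⊥)
  stage-within step (suc k) x∈  = step (stage k) (stage-within step k) x∈

-- Every set with a decidable, upward-closed property P contains a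
-- ⊂-minimal set with property P (remove elements while P survives).
minimal-below : {P : Pred (Subset n) ℓ} → Decidable P →
  (∀ {p q} → p ⊆ q → P p → P q) →
  ∀ p → P p → ∃ λ q → q ⊆ p × P q × (∀ r → r ⊂ q → ¬ P r)
minimal-below {P = P} P? upward p Pp = shrink p Pp (<-wellFounded ∣ p ∣)
  where
  shrink : ∀ p → P p → Acc _<_ ∣ p ∣ → ∃ λ q → q ⊆ p × P q × (∀ r → r ⊂ q → ¬ P r)
  shrink p Pp (acc smaller) with any? (λ x → x ∈? p ×-dec P? (p - x))
  ... | yes (x , x∈p , Pp-x) with shrink (p - x) Pp-x (smaller (x∈p⇒∣p-x∣<∣p∣ x∈p))
  ...   | q , q⊆p-x , Pq , minimal = q , p─q⊆p _ _ ∘ q⊆p-x , Pq , minimal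
  shrink p Pp (acc _) | no irreducible =
    p , id , Pp , λ { r (r⊆p , x , x∈p , x∉r) Pr →
      irreducible (x , x∈p , upward (λ y∈r → x∈p∧x≢y⇒x∈p-y (r⊆p y∈r) (λ { refl → x∉r y∈r })) Pr) }

module _ (O : PNet) where
  open PNet O
  open DecLM (_≟ᶠ_ {nt}) using () renaming (_∈?_ to _∈σ?_)

  NoPreset : Place → Set
  NoPreset s = (u : Trans) → outF u s ≡ false

  noPreset⇔ : ∀ s → NoPreset s ⇔ hasPreset s ≡ false
  noPreset⇔ s = mk⇔ to from
    where
    to : NoPreset s → hasPreset s ≡ false
    to none with hasPreset s in has
    ... | false = refl
    ... | true with satisfied (any⁻ (λ u → outF u s) (allFin nt) (Equivalence.from T-≡ has))
    ...   | u , T-out = ⊥-elim (subst T (none u) T-out)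
    from : hasPreset s ≡ false → NoPreset s
    from none u with outF u s in out
    ... | false = refl
    ... | true  = ⊥-elim (subst T none
                    (any⁺ (λ u → outF u s) (LM.lose (∈-allFin u) (Equivalence.from T-≡ out))))

  initial⇔noPreset : ∀ s → Marked initial s ⇔ NoPreset s
  initial⇔noPreset s = mk⇔ (Equivalence.from (noPreset⇔ s) ∘ unmarked s)
                           (marked s ∘ Equivalence.to (noPreset⇔ s))
    where
    marked : ∀ s → hasPreset s ≡ false → Marked initial s
    marked (inj₁ p) h rewrite h = s≤s z≤n
    marked (inj₂ q) h rewrite h = refl
    unmarked : ∀ s → Marked initial s → hasPreset s ≡ false
    unmarked (inj₁ p) m with hasPreset (inj₁ p)
    unmarked (inj₁ p) m  | false = refl
    unmarked (inj₁ p) () | true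
    unmarked (inj₂ q) m with hasPreset (inj₂ q)
    unmarked (inj₂ q) m  | false = refl
    unmarked (inj₂ q) () | true

  Justified : Valuation → State → Set
  Justified v b = ∀ s → Marked b s → SatP v s

  -- Firing a transition true under v keeps the state justified: a newly
  -- marked place is justified by that transition, whose inputs were marked.
  fire-justified : ∀ {v b t} → Justified v b → Enabled b t → v t ≡ true →
                   Justified v (fire b t)
  fire-justified {v} {b} {t} just en vt (inj₁ p) m with outF t (inj₁ p) in out
  ... | true  = viaPre t out vt (λ s s∈•t → just s (en s s∈•t))
  ... | false = just (inj₁ p) (≤-trans (subst (1 ≤_) (+-identityʳ _) m)
                                       (m∸n≤m (reg b p) (ind (inF (inj₁ p) t))))
  fire-justified {v} {b} {t} just en vt (inj₂ q) m with pers b q in was | outF t (inj₂ q) in out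
  ... | true  | _    = just (inj₂ q) was
  ... | false | true = viaPre t out vt (λ s s∈•t → just s (en s s∈•t))

  run-justified : ∀ {v b σ b'} → FiringSeq b σ b' → (∀ u → u LM.∈ σ → v u ≡ true) →
                  Justified v b → Justified v b'
  run-justified []           σ-true just = just
  run-justified (en ∷ run)   σ-true just =
    run-justified run (λ u → σ-true u ∘ there) (fire-justified just en (σ-true _ (here refl)))

  -- (i) ⇒ (iii): the initial state is justified, as only places with empty
  -- preset are marked, and the input places of t are marked after σ.
  enabled⇒conjImplies : ∀ {σ b t} → FiringSeq initial σ b → Enabled b t → ConjImplies σ t
  enabled⇒conjImplies run en v σ-true s s∈•t =
    run-justified run σ-true initial-justified s (en s s∈•t)
    where
    initial-justified : Justified v initial
    initial-justified s m = noPre (Equivalence.to (initial⇔noPreset s) m)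

  Preserves : Trans → Place → Set
  Preserves u s = ∀ b → Marked b s → Marked (fire b u) s

  persistent-preserved : ∀ u q → Preserves u (inj₂ q)
  persistent-preserved u q b m rewrite m = refl

  unconsumed-preserved : ∀ u p → inF (inj₁ p) u ≡ false → Preserves u (inj₁ p)
  unconsumed-preserved u p notIn b m rewrite notIn = ≤-trans m (m≤m+n _ _)

  produced : ∀ u s → outF u s ≡ true → ∀ b → Marked (fire b u) s
  produced u (inj₁ p) out b rewrite out = m≤n+m 1 _
  produced u (inj₂ q) out b rewrite out = ∨-zeroʳ (pers b q)

  stays-marked : ∀ {s b σ b'} → FiringSeq b σ b' → (∀ u → u LM.∈ σ → Preserves u s) →
                 Marked b s → Marked b' s
  stays-marked []         keep m = m
  stays-marked (_ ∷ run)  keep m = stays-marked run (λ u → keep u ∘ there) (keep _ (here refl) _ m)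

  marked-after-producer : ∀ {s b σ b' u} → FiringSeq b σ b' →
    (∀ u → u LM.∈ σ → Preserves u s) → u LM.∈ σ → outF u s ≡ true → Marked b' s
  marked-after-producer (_ ∷ run) keep (here refl) out =
    stays-marked run (λ u → keep u ∘ there) (produced _ _ out _)
  marked-after-producer (_ ∷ run) keep (there u∈σ) out =
    marked-after-producer run (λ u → keep u ∘ there) u∈σ out

  -- In an occurrence net t is the only consumer of its regular input
  -- places, so transitions other than t preserve every input place of t.
  inputs-preserved : IsOccurrence → ∀ {σ t} → LM._∉_ t σ →
    ∀ s → inF s t ≡ true → ∀ u → u LM.∈ σ → Preserves u s
  inputs-preserved occ t∉σ (inj₂ q) s∈•t u u∈σ = persistent-preserved u q
  inputs-preserved occ {σ} t∉σ (inj₁ p) p∈•t u u∈σ = unconsumed-preserved u p not-consumed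
    where
    not-consumed : inF (inj₁ p) u ≡ false
    not-consumed with inF (inj₁ p) u in p∈•u
    ... | false = refl
    ... | true  = ⊥-elim (t∉σ (subst (LM._∈ σ) (IsOccurrence.regPost occ p u _ p∈•u p∈•t) u∈σ))

  occurs : List Trans → Valuation
  occurs σ u = does (u ∈σ? σ)

  -- (iii) ⇒ (i): at the characteristic valuation of σ each input place of t
  -- has empty preset or a producer in σ; either way it is marked after σ.
  conjImplies⇒enabled : IsOccurrence → ∀ {σ b t} → FiringSeq initial σ b → LM._∉_ t σ →
                        ConjImplies σ t → Enabled b t
  conjImplies⇒enabled occ {σ} run t∉σ implies s s∈•t
    with implies (occurs σ) (λ u → dec-true (u ∈σ? σ)) s s∈•t
  ... | noPre none =
    stays-marked run (inputs-preserved occ t∉σ s s∈•t) (Equivalence.from (initial⇔noPreset s) none)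
  ... | viaPre u out u-occurs _ =
    marked-after-producer run (inputs-preserved occ t∉σ s s∈•t) (does⇒ (u ∈σ? σ) u-occurs) out

  Supplied : Valuation → Subset nt → Place → Set
  Supplied v X s = NoPreset s ⊎ ∃ λ w → outF w s ≡ true × v w ≡ true × w ∈ X

  supplied? : ∀ v X s → Dec (Supplied v X s)
  supplied? v X s =
    all? (λ u → outF u s ≟ᵇ false)
      ⊎-dec any? (λ w → (outF w s ≟ᵇ true) ×-dec (v w ≟ᵇ true) ×-dec (w ∈? X))

  Fed : Valuation → Subset nt → Trans → Set
  Fed v X u = ∀ s → inF s u ≡ true → Supplied v X s

  fed? : ∀ v X u → Dec (Fed v X u)
  fed? v X u = all⊎? (λ s → (inF s u ≟ᵇ true) →-dec supplied? v X s)

  -- The transitions satisfying their cause formula under v are the least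
  -- fixpoint of X ↦ {u | u fed by X}; Kleene iteration computes it.
  module Satisfaction (v : Valuation) where

    feed : Subset nt → Subset nt
    feed X = ⟦ fed? v X ⟧

    feed-mono : ∀ {X Y} → X ⊆ Y → feed X ⊆ feed Y
    feed-mono X⊆Y u∈ = Equivalence.from (∈⟦⟧⇔ (fed? v _)) λ s s∈•u →
      widen (Equivalence.to (∈⟦⟧⇔ (fed? v _)) u∈ s s∈•u)
      where
      widen : ∀ {s} → Supplied v _ s → Supplied v _ s
      widen (inj₁ none)               = inj₁ none
      widen (inj₂ (w , out , vw , w∈X)) = inj₂ (w , out , vw , X⊆Y w∈X)

    open Kleene feed feed-mono using (fixpoint; fixpoint-closed; stage-within)

    sound : ∀ {u} → u ∈ fixpoint → SatT v u
    sound = stage-within feed-sound (suc nt)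
      where
      feed-sound : ∀ X → (∀ {w} → w ∈ X → SatT v w) → ∀ {u} → u ∈ feed X → SatT v u
      feed-sound X X-sat u∈ s s∈•u with Equivalence.to (∈⟦⟧⇔ (fed? v X)) u∈ s s∈•u
      ... | inj₁ none                  = noPre none
      ... | inj₂ (w , out , vw , w∈X)  = viaPre w out vw (X-sat w∈X)

    -- Conversely Φ holds only inside the fixpoint, as the fixpoint is closed.
    complete-P : ∀ {s} → SatP v s → Supplied v fixpoint s
    complete-T : ∀ {u} → SatT v u → u ∈ fixpoint
    complete-P (noPre none)          = inj₁ none
    complete-P (viaPre w out vw sat) = inj₂ (w , out , vw , complete-T sat)
    complete-T sat = fixpoint-closed
      (Equivalence.from (∈⟦⟧⇔ (fed? v fixpoint)) (λ s s∈•u → complete-P (sat s s∈•u)))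

    sat? : ∀ t → Dec (SatT v t)
    sat? t = map′ sound complete-T (t ∈? fixpoint)

  SatP-mono : ∀ {v w s} → (∀ u → v u ≡ true → w u ≡ true) → SatP v s → SatP w s
  SatP-mono v≤w (noPre none)          = noPre none
  SatP-mono v≤w (viaPre u out vu sat) = viaPre u out (v≤w u vu) (λ s s∈•u → SatP-mono v≤w (sat s s∈•u))

  implicant⇔ : ∀ C t → Implicant C t ⇔ SatT (lookup C) t
  implicant⇔ C t = mk⇔
    (λ imp → imp (lookup C) (λ u → Equivalence.from (lookup⇔∈ C)))
    (λ sat v C-true s s∈•t →
       SatP-mono (λ u Cu → C-true u (Equivalence.to (lookup⇔∈ C) Cu)) (sat s s∈•t))

  implicant? : ∀ t C → Dec (Implicant C t)
  implicant? t C = map′ (Equivalence.from (implicant⇔ C t)) (Equivalence.to (implicant⇔ C t))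
                        (Satisfaction.sat? (lookup C) t)

  implicant-upward : ∀ {t D E} → D ⊆ E → Implicant D t → Implicant E t
  implicant-upward D⊆E imp v E-true = imp v (λ u → E-true u ∘ D⊆E)

  CausesWithin : List Trans → Trans → Set
  CausesWithin σ t = ∃ λ C → CollectionOfCauses C t × ((u : Trans) → u ∈ C → u LM.∈ σ)

  -- (iii) ⇒ (ii): the set of transitions occurring in σ is an implicant of Φ(t), hence
  -- contains a minimal implicant, i.e. a collection of causes.
  conjImplies⇒causes : ∀ {σ t} → ConjImplies σ t → CausesWithin σ t
  conjImplies⇒causes {σ} {t} implies =
    let C , C⊆σ , C-implies , minimal = minimal-below (implicant? t) implicant-upward occurring σ-implies
    in  C , (C-implies , minimal) , λ u → Equivalence.to (∈⟦⟧⇔ (_∈σ? σ)) ∘ C⊆σ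
    where
    occurring : Subset nt
    occurring = ⟦ _∈σ? σ ⟧
    σ-implies : Implicant occurring t
    σ-implies v σ-true = implies v (λ u → σ-true u ∘ Equivalence.from (∈⟦⟧⇔ (_∈σ? σ)))

  causes⇒conjImplies : ∀ {σ t} → CausesWithin σ t → ConjImplies σ t
  causes⇒conjImplies (C , (C-implies , _) , C⊆σ) v σ-true = C-implies v (λ u → σ-true u ∘ C⊆σ u)

theorem5p3 : (O : PNet) → PNet.IsOccurrence O →
    (σ : List (PNet.Trans O)) (b : PNet.State O) →
    PNet.FiringSeq O (PNet.initial O) σ b → PNet.NonStuttering O σ →
    (t : PNet.Trans O) → LM._∉_ t σ →
    (PNet.Enabled O b t ⇔ (∃ λ (C : Subset (PNet.nt O)) → PNet.CollectionOfCauses O C t × ((u : PNet.Trans O) → u ∈ C → LM._∈_ u σ)))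
    × (PNet.Enabled O b t ⇔ PNet.ConjImplies O σ t)
theorem5p3 O occ σ b run _ t t∉σ = (i⇔ii , i⇔iii)
  where
  i⇔iii : PNet.Enabled O b t ⇔ PNet.ConjImplies O σ t
  i⇔iii = mk⇔ (enabled⇒conjImplies O run) (conjImplies⇒enabled O occ run t∉σ)

  i⇔ii : PNet.Enabled O b t ⇔ CausesWithin O σ t
  i⇔ii = mk⇔ (conjImplies⇒causes O ∘ Equivalence.to i⇔iii)
             (Equivalence.from i⇔iii ∘ causes⇒conjImplies O)
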